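{- Let $k\ge 3$ and $\lambda:=\frac{k}{k-2}$. For every integer $x\ge1$, the function $t\mapsto i(x,t)/k^t$, restricted to positive integers $t$ with $t\equiv x\pmod 2$, is unimodal, and $i(x,t)/k^t$ is maximized over all $t\in\mathbb{N}$ at some $t_{\max}(x)=\lambda x+c_x$ with $|c_x|\le 15$.
   Context: Define $i(x,t)$ for integers $x,t\ge0$ by $i(x,0)=0$ for all $x\ge0$, $i(0,t)=0$ for all $t\ge0$, $i(1,1)=k-1$, and $i(x,t)=i(x-1,t-1)+(k-1)\,i(x+1,t-1)$ for all $(x,t)\in\mathbb{N}_{\ge1}^2\setminus\{(1,1)\}$. (Equivalently, for $x,t>0$, $i(x,t)=(k-1)^{\frac{t-x}{2}+1}\frac{x}{t}\binom{t}{\frac{t+x}{2}}$, interpreted as $0$ unless $t\ge x$ and $t\equiv x \pmod 2$.) A function $g$ on a set $X\subseteq\mathbb{R}$ is unimodal if there is $t_1\in X$ such that $g$ is monotone on $\{t\in X: t\le t_1\}$ and monotone on $\{t\in X:t\ge t_1\}$. -}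

module Defs where

open import Data.Nat using (ℕ; zero; suc; _+_; _*_; _∸_; _^_; _≤_; _%_)
open import Data.Nat.Properties using (m^n≢0)
open import Data.Integer using (+_)
open import Data.Rational as ℚ using (ℚ; _/_)
open import Data.Product using (Σ; _×_)
open import Data.Sum using (_⊎_)

i : ℕ → ℕ → ℕ → ℕ
i k zero t = 0
i k (suc x) zero = 0
i k (suc zero) (suc zero) = k ∸ 1
i k (suc x) (suc t) = i k x t + (k ∸ 1) * i k (suc (suc x)) t

-- ratio k x t = i(x,t) / k^t as a rational (junk value 0 when k = 0).
ratio : ℕ → ℕ → ℕ → ℚ
ratio zero x t = ℚ.0ℚ
ratio k@(suc _) x t = (+ i k x t) / (k ^ t)
  where instance _ = m^n≢0 k t

-- λ = k/(k-2) as a rational (junk value 0 when k < 3, never used).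
lam : ℕ → ℚ
lam (suc (suc (suc m))) = (+ (3 + m)) / (suc m)
lam _ = ℚ.0ℚ

MonotoneOn : (ℕ → Set) → (ℕ → ℚ) → Set
MonotoneOn P g =
  (∀ s t → P s → P t → s ≤ t → g s ℚ.≤ g t) ⊎
  (∀ s t → P s → P t → s ≤ t → g t ℚ.≤ g s)

UnimodalOn : (ℕ → Set) → (ℕ → ℚ) → Set
UnimodalOn X g = Σ ℕ λ t₁ → X t₁ ×
  MonotoneOn (λ t → X t × t ≤ t₁) g ×
  MonotoneOn (λ t → X t × t₁ ≤ t) g

module Submission where

-- Write R(t) = i(x,t)/k^t.  Off the class t = x + 2b the numbers i(x,t) vanish, and on it
-- the ballot-number closed form t·i(x,t) = x (k−1)^(b+1) C(t,b) gives
--   R(t+2) / R(t) = (k−1) t (t+1) / (k² (x+b+1)(b+1)).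
-- This ratio is ≥ 1 when (k−2)(b+1) + 6 ≤ x, is < 1 when x ≤ (k−2) b, and once it drops
-- below 1 it stays there.  So R rises along the class up to the first b* with ratio < 1
-- and falls afterwards, and the two conditions pin b* to x/(k−2) up to a constant, which
-- puts t* = x + 2b* within 15 of k x/(k−2).

open import Defs
open import Data.Nat
  using (ℕ; zero; suc; _+_; _*_; _∸_; _^_; _≤_; _<_; _%_; z≤n; s≤s; _≤?_; NonZero; >-nonZero)
open import Data.Nat.Properties
open import Algebra.Properties.CommutativeSemigroup *-commutativeSemigroup using (x∙yz≈y∙xz)
open import Data.Nat.Combinatorics using (_C_; nC1≡n; nCk+nC[k+1]≡[n+1]C[k+1])
open import Data.Nat.DivMod using (_/_; m≡m%n+[m/n]*n; /-monoˡ-≤; [m+kn]%n≡m%n)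
open import Data.Nat.Tactic.RingSolver using (solve-∀)
open import Data.Integer as ℤ using (+_; _⊖_)
import Data.Integer.Properties as ℤP
import Data.Integer.Tactic.RingSolver as ℤSolver
open import Data.Rational as ℚ using (ℚ)
import Data.Rational.Properties as ℚP
open import Data.Rational.Unnormalised as ℚᵘ using (mkℚᵘ; *≡*; *≤*)
import Data.Rational.Unnormalised.Properties as ℚᵘP
open import Data.Product using (Σ; ∃-syntax; _×_; _,_; proj₁; proj₂)
open import Data.Sum using (_⊎_; inj₁; inj₂; [_,_]′)
open import Relation.Binary.Core using (Rel)
open import Relation.Binary.Definitions using (Reflexive; Transitive)
open import Relation.Binary.PropositionalEquality
open import Relation.Nullary using (¬_; yes; no)
open import Relation.Nullary.Negation using (contradiction)
open import Relation.Unary using (Pred; Decidable)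
open import Function.Base using (_∘_)

least-failure : ∀ {p} {P : Pred ℕ p} → Decidable P → ∀ n → ¬ P n →
                ∃[ b ] ¬ P b × (∀ c → c < b → P c)
least-failure P? zero ¬P0 = zero , ¬P0 , λ _ ()
least-failure {P = P} P? (suc n) ¬P[1+n] with P? zero
... | no ¬P0 = zero , ¬P0 , λ _ ()
... | yes P0 with least-failure {P = λ c → P (suc c)} (λ c → P? (suc c)) n ¬P[1+n]
...   | b , ¬P[1+b] , below = suc b , ¬P[1+b] , λ where
        zero    _           → P0
        (suc c) (s≤s c<b) → below c c<b

module _ {a ℓ} {A : Set a} {_≼_ : Rel A ℓ}
         (≼-refl : Reflexive _≼_) (≼-trans : Transitive _≼_) (f : ℕ → A) where

  ascending-upto : ∀ {n} → (∀ b → b < n → f b ≼ f (suc b)) →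
                   ∀ {b c} → b ≤ c → c ≤ n → f b ≼ f c
  ascending-upto step {c = zero}  z≤n _ = ≼-refl
  ascending-upto step {c = suc c} b≤1+c 1+c≤n with m≤n⇒m<n∨m≡n b≤1+c
  ... | inj₂ refl      = ≼-refl
  ... | inj₁ (s≤s b≤c) = ≼-trans (ascending-upto step b≤c (<⇒≤ 1+c≤n)) (step c 1+c≤n)

  descending-from : ∀ {n} → (∀ b → n ≤ b → f (suc b) ≼ f b) →
                    ∀ {b c} → n ≤ b → b ≤ c → f c ≼ f b
  descending-from step {c = zero}  _ z≤n = ≼-refl
  descending-from step {c = suc c} n≤b b≤1+c with m≤n⇒m<n∨m≡n b≤1+c
  ... | inj₂ refl      = ≼-refl
  ... | inj₁ (s≤s b≤c) = ≼-trans (step c (≤-trans n≤b b≤c)) (descending-from step n≤b b≤c)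

parity-gap : ∀ {x t} → x ≤ t → t % 2 ≡ x % 2 → ∃[ b ] t ≡ x + 2 * b
parity-gap {x} {t} x≤t t%2≡x%2 = d , (begin
    t                               ≡⟨ m≡m%n+[m/n]*n t 2 ⟩
    t % 2 + t / 2 * 2               ≡⟨ cong₂ (λ r q → r + q * 2) t%2≡x%2 (sym (m+[n∸m]≡n x/2≤t/2)) ⟩
    x % 2 + (x / 2 + d) * 2         ≡⟨ regroup (x % 2) (x / 2) d ⟩
    (x % 2 + x / 2 * 2) + 2 * d     ≡⟨ cong (_+ 2 * d) (m≡m%n+[m/n]*n x 2) ⟨
    x + 2 * d                       ∎)
  where
  open ≡-Reasoning
  x/2≤t/2 : x / 2 ≤ t / 2
  x/2≤t/2 = /-monoˡ-≤ 2 x≤t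
  d : ℕ
  d = t / 2 ∸ x / 2
  regroup : ∀ r q d → r + (q + d) * 2 ≡ (r + q * 2) + 2 * d
  regroup = solve-∀

p*[c*u]≡c*p*u : ∀ p c u → p * (c * u) ≡ c * p * u
p*[c*u]≡c*p*u = solve-∀

p*v≡q*u⇒c*p≤q⇒c*u≤v : ∀ {p q u v} c .{{_ : NonZero p}} → p * v ≡ q * u → c * p ≤ q → c * u ≤ v
p*v≡q*u⇒c*p≤q⇒c*u≤v {p} {q} {u} {v} c eq cp≤q = *-cancelˡ-≤ p (begin
    p * (c * u)  ≡⟨ p*[c*u]≡c*p*u p c u ⟩
    c * p * u    ≤⟨ *-monoˡ-≤ u cp≤q ⟩
    q * u        ≡⟨ eq ⟨
    p * v        ∎)
  where open ≤-Reasoning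

p*v≡q*u⇒q≤c*p⇒v≤c*u : ∀ {p q u v} c .{{_ : NonZero p}} → p * v ≡ q * u → q ≤ c * p → v ≤ c * u
p*v≡q*u⇒q≤c*p⇒v≤c*u {p} {q} {u} {v} c eq q≤cp = *-cancelˡ-≤ p (begin
    p * v        ≡⟨ eq ⟩
    q * u        ≤⟨ *-monoˡ-≤ u q≤cp ⟩
    c * p * u    ≡⟨ p*[c*u]≡c*p*u p c u ⟨
    p * (c * u)  ∎)
  where open ≤-Reasoning

[k+1]*[n+1]C[k+1]≡[n+1]*nCk : ∀ n k → suc k * (suc n C suc k) ≡ suc n * (n C k)
[k+1]*[n+1]C[k+1]≡[n+1]*nCk zero    zero    = refl
[k+1]*[n+1]C[k+1]≡[n+1]*nCk zero    (suc k) = *-zeroʳ (2 + k)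
[k+1]*[n+1]C[k+1]≡[n+1]*nCk (suc n) zero    =
  trans (+-identityʳ _) (trans (nC1≡n (2 + n)) (sym (*-identityʳ (2 + n))))
[k+1]*[n+1]C[k+1]≡[n+1]*nCk (suc n) (suc k) = begin
    (2 + k) * ((2 + n) C (2 + k))
  ≡⟨ cong ((2 + k) *_) (nCk+nC[k+1]≡[n+1]C[k+1] (suc n) (suc k)) ⟨
    (2 + k) * ((1 + n) C (1 + k) + (1 + n) C (2 + k))
  ≡⟨ *-distribˡ-+ (2 + k) ((1 + n) C (1 + k)) _ ⟩
    ((1 + n) C (1 + k) + (1 + k) * ((1 + n) C (1 + k))) + (2 + k) * ((1 + n) C (2 + k))
  ≡⟨ cong₂ (λ u v → ((1 + n) C (1 + k) + u) + v)
           ([k+1]*[n+1]C[k+1]≡[n+1]*nCk n k) ([k+1]*[n+1]C[k+1]≡[n+1]*nCk n (suc k)) ⟩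
    ((1 + n) C (1 + k) + (1 + n) * (n C k)) + (1 + n) * (n C (1 + k))
  ≡⟨ factor ((1 + n) C (1 + k)) (n C k) (n C (1 + k)) n ⟩
    (1 + n) C (1 + k) + (1 + n) * (n C k + n C (1 + k))
  ≡⟨ cong (λ c → (1 + n) C (1 + k) + (1 + n) * c) (nCk+nC[k+1]≡[n+1]C[k+1] n k) ⟩
    (2 + n) * ((1 + n) C (1 + k))
  ∎
  where
  open ≡-Reasoning
  factor : ∀ a b c n → (a + suc n * b) + suc n * c ≡ a + suc n * (b + c)
  factor = solve-∀

[n+1]*nCk+k*[n+1]Ck≡[n+1]*[n+1]Ck : ∀ n k → suc n * (n C k) + k * (suc n C k) ≡ suc n * (suc n C k)
[n+1]*nCk+k*[n+1]Ck≡[n+1]*[n+1]Ck n zero    = +-identityʳ _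
[n+1]*nCk+k*[n+1]Ck≡[n+1]*[n+1]Ck n (suc k) = begin
    suc n * (n C suc k) + suc k * (suc n C suc k)
  ≡⟨ cong (λ v → suc n * (n C suc k) + v) ([k+1]*[n+1]C[k+1]≡[n+1]*nCk n k) ⟩
    suc n * (n C suc k) + suc n * (n C k)
  ≡⟨ +-comm (suc n * (n C suc k)) _ ⟩
    suc n * (n C k) + suc n * (n C suc k)
  ≡⟨ *-distribˡ-+ (suc n) (n C k) _ ⟨
    suc n * (n C k + n C suc k)
  ≡⟨ cong (suc n *_) (nCk+nC[k+1]≡[n+1]C[k+1] n k) ⟩
    suc n * (suc n C suc k)
  ∎
  where open ≡-Reasoning

ballot-recurrence : ∀ x b t → t ≡ x + 2 * suc b →
  x * (suc t * (t C suc b)) + (2 + x) * (suc t * (t C b)) ≡ suc x * (suc t C suc b) * t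
ballot-recurrence x b t refl = begin
    x * (suc t * (t C suc b)) + (2 + x) * (suc t * (t C b))
  ≡⟨ cong (λ c → x * (suc t * (t C suc b)) + (2 + x) * c) ([k+1]*[n+1]C[k+1]≡[n+1]*nCk t b) ⟨
    x * (suc t * (t C suc b)) + (2 + x) * (suc b * (suc t C suc b))
  ≡⟨ split x (suc t * (t C suc b)) (suc b * (suc t C suc b)) ⟩
    x * (suc t * (t C suc b) + suc b * (suc t C suc b)) + 2 * (suc b * (suc t C suc b))
  ≡⟨ cong (λ c → x * c + 2 * (suc b * (suc t C suc b))) ([n+1]*nCk+k*[n+1]Ck≡[n+1]*[n+1]Ck t (suc b)) ⟩
    x * (suc t * (suc t C suc b)) + 2 * (suc b * (suc t C suc b))
  ≡⟨ expand x b (suc t C suc b) ⟩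
    suc x * (suc t C suc b) * t
  ∎
  where
  open ≡-Reasoning
  split : ∀ x u v → x * u + (2 + x) * v ≡ x * (u + v) + 2 * v
  split = solve-∀
  expand : ∀ x b c → x * (suc (x + 2 * suc b) * c) + 2 * (suc b * c) ≡ suc x * c * (x + 2 * suc b)
  expand = solve-∀

ballot-two-step : ∀ X b t → t ≡ X + 2 * b →
  (X + suc b) * (suc b * ((2 + t) C suc b)) ≡ (2 + t) * (suc t * (t C b))
ballot-two-step X b t refl = begin
    (X + suc b) * (suc b * ((2 + t) C suc b))
  ≡⟨ cong ((X + suc b) *_) ([k+1]*[n+1]C[k+1]≡[n+1]*nCk (suc t) b) ⟩
    (X + suc b) * ((2 + t) * ((1 + t) C b))
  ≡⟨ x∙yz≈y∙xz (X + suc b) (2 + t) _ ⟩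
    (2 + t) * ((X + suc b) * ((1 + t) C b))
  ≡⟨ cong ((2 + t) *_) complement ⟩
    (2 + t) * (suc t * (t C b))
  ∎
  where
  open ≡-Reasoning
  complement : (X + suc b) * ((1 + t) C b) ≡ suc t * (t C b)
  complement = +-cancelʳ-≡ (b * ((1 + t) C b)) _ _ (begin
      (X + suc b) * ((1 + t) C b) + b * ((1 + t) C b)
    ≡⟨ split X b ((1 + t) C b) ⟩
      suc t * ((1 + t) C b)
    ≡⟨ [n+1]*nCk+k*[n+1]Ck≡[n+1]*[n+1]Ck t b ⟨
      suc t * (t C b) + b * ((1 + t) C b)
    ∎)
    where
    split : ∀ X b c → (X + suc b) * c + b * c ≡ suc (X + 2 * b) * c
    split = solve-∀

i-support : ∀ k x t → i k x t ≡ 0 ⊎ ∃[ b ] t ≡ x + 2 * b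
i-support k zero          t             = inj₁ refl
i-support k (suc x)       zero          = inj₁ refl
i-support k (suc zero)    (suc zero)    = inj₂ (0 , refl)
i-support k (suc zero)    (suc (suc t)) with i-support k 2 (suc t)
... | inj₁ i≡0      = inj₁ (trans (cong ((k ∸ 1) *_) i≡0) (*-zeroʳ (k ∸ 1)))
... | inj₂ (b , eq) = inj₂ (suc b , trans (cong suc eq) (shift b))
  where
  shift : ∀ b → 3 + 2 * b ≡ 1 + 2 * suc b
  shift = solve-∀
i-support k (suc (suc x)) (suc t)       with i-support k (suc x) t | i-support k (3 + x) t
... | inj₂ (b , eq) | _             = inj₂ (b , cong suc eq)
... | inj₁ _        | inj₂ (b , eq) = inj₂ (suc b , trans (cong suc eq) (shift x b))
  where
  shift : ∀ x b → 4 + x + 2 * b ≡ 2 + x + 2 * suc b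
  shift = solve-∀
... | inj₁ i₁≡0     | inj₁ i₂≡0     =
  inj₁ (trans (cong₂ (λ u v → u + (k ∸ 1) * v) i₁≡0 i₂≡0) (*-zeroʳ (k ∸ 1)))

i-below-diagonal : ∀ k {x t} → t < x → i k x t ≡ 0
i-below-diagonal k {x} {t} t<x with i-support k x t
... | inj₁ i≡0       = i≡0
... | inj₂ (b , refl) = contradiction (m≤m+n x (2 * b)) (<⇒≱ t<x)

i-diagonal : ∀ k x → i k (suc x) (suc x) ≡ k ∸ 1
i-diagonal k zero = refl
i-diagonal k (suc x)
  rewrite i-diagonal k x | i-below-diagonal k {3 + x} {suc x} (n≤1+n (2 + x)) | *-zeroʳ (k ∸ 1) =
  +-identityʳ (k ∸ 1)

i-recurrence : ∀ k x t → 0 < t → i k (suc x) (suc t) ≡ i k x t + (k ∸ 1) * i k (2 + x) t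
i-recurrence k zero    (suc t) _ = refl
i-recurrence k (suc x) (suc t) _ = refl

-- The paper's formula at t = X + 2b, times t; note (t+X)/2 = X + b and C(t, X+b) = C(t, b).
i-closed-form : ∀ k X b → i k X (X + 2 * b) * (X + 2 * b) ≡ X * (k ∸ 1) ^ suc b * ((X + 2 * b) C b)
i-closed-form k zero    b    = refl
i-closed-form k (suc x) zero rewrite +-identityʳ x | i-diagonal k x = rearrange (k ∸ 1) x
  where
  rearrange : ∀ K x → K * suc x ≡ suc x * (K * 1) * 1
  rearrange = solve-∀
i-closed-form k (suc x) (suc b) = *-cancelʳ-≡ _ _ s {{>-nonZero 0<s}} (begin
    i k (suc x) (suc s) * suc s * s
  ≡⟨ cong (λ v → v * suc s * s) (i-recurrence k x s 0<s) ⟩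
    (i k x s + K * i k (2 + x) s) * suc s * s
  ≡⟨ distribute (i k x s) (i k (2 + x) s) K s ⟩
    suc s * (i k x s * s) + K * suc s * (i k (2 + x) s * s)
  ≡⟨ cong₂ (λ u v → suc s * u + K * suc s * v) (i-closed-form k x (suc b)) IH ⟩
    suc s * (x * (K * P) * (s C suc b)) + K * suc s * ((2 + x) * P * (s C b))
  ≡⟨ collect x K P (s C suc b) (s C b) s ⟩
    K * P * (x * (suc s * (s C suc b)) + (2 + x) * (suc s * (s C b)))
  ≡⟨ cong (K * P *_) (ballot-recurrence x b s refl) ⟩
    K * P * (suc x * (suc s C suc b) * s)
  ≡⟨ reassociate K P (suc x) (suc s C suc b) s ⟩
    suc x * (K * P) * (suc s C suc b) * s
  ∎)
  where
  open ≡-Reasoning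
  K P s : ℕ
  K = k ∸ 1
  P = K ^ suc b
  s = x + 2 * suc b
  0<s : 0 < s
  0<s = ≤-trans (s≤s z≤n) (m≤n+m (2 * suc b) x)
  s≡2+x+2b : s ≡ 2 + x + 2 * b
  s≡2+x+2b = shift x b
    where
    shift : ∀ x b → x + 2 * suc b ≡ 2 + x + 2 * b
    shift = solve-∀
  IH : i k (2 + x) s * s ≡ (2 + x) * P * (s C b)
  IH = subst (λ t → i k (2 + x) t * t ≡ (2 + x) * P * (t C b)) (sym s≡2+x+2b) (i-closed-form k (2 + x) b)
  distribute : ∀ u v K s → (u + K * v) * suc s * s ≡ suc s * (u * s) + K * suc s * (v * s)
  distribute = solve-∀
  collect : ∀ x K P c d s → suc s * (x * (K * P) * c) + K * suc s * ((2 + x) * P * d)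
                         ≡ K * P * (x * (suc s * c) + (2 + x) * (suc s * d))
  collect = solve-∀
  reassociate : ∀ K P y c s → K * P * (y * c * s) ≡ y * (K * P) * c * s
  reassociate = solve-∀

i-two-step : ∀ k X b →
  (X + suc b) * suc b * i k X (2 + (X + 2 * b)) ≡ (k ∸ 1) * (X + 2 * b) * suc (X + 2 * b) * i k X (X + 2 * b)
i-two-step k X b = *-cancelʳ-≡ _ _ (2 + t) (begin
    (X + suc b) * suc b * i k X (2 + t) * (2 + t)
  ≡⟨ *-assoc ((X + suc b) * suc b) _ _ ⟩
    (X + suc b) * suc b * (i k X (2 + t) * (2 + t))
  ≡⟨ cong ((X + suc b) * suc b *_) IH₂ ⟩
    (X + suc b) * suc b * (X * (K * P) * ((2 + t) C suc b))
  ≡⟨ regroup (X + suc b) (suc b) X (K * P) ((2 + t) C suc b) ⟩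
    X * (K * P) * ((X + suc b) * (suc b * ((2 + t) C suc b)))
  ≡⟨ cong (X * (K * P) *_) (ballot-two-step X b t refl) ⟩
    X * (K * P) * ((2 + t) * (suc t * (t C b)))
  ≡⟨ regroup′ X K P t (t C b) ⟩
    K * suc t * (X * P * (t C b)) * (2 + t)
  ≡⟨ cong (λ v → K * suc t * v * (2 + t)) (i-closed-form k X b) ⟨
    K * suc t * (i k X t * t) * (2 + t)
  ≡⟨ regroup″ K t (i k X t) ⟩
    K * t * suc t * i k X t * (2 + t)
  ∎)
  where
  open ≡-Reasoning
  K P t : ℕ
  K = k ∸ 1
  P = K ^ suc b
  t = X + 2 * b
  IH₂ : i k X (2 + t) * (2 + t) ≡ X * (K * P) * ((2 + t) C suc b)
  IH₂ = subst (λ u → i k X u * u ≡ X * (K * P) * (u C suc b)) (shift X b) (i-closed-form k X (suc b))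
    where
    shift : ∀ X b → X + 2 * suc b ≡ 2 + (X + 2 * b)
    shift = solve-∀
  regroup : ∀ a b X Q c → a * b * (X * Q * c) ≡ X * Q * (a * (b * c))
  regroup = solve-∀
  regroup′ : ∀ X K P t c → X * (K * P) * ((2 + t) * (suc t * c)) ≡ K * suc t * (X * P * c) * (2 + t)
  regroup′ = solve-∀
  regroup″ : ∀ K t v → K * suc t * (v * t) * (2 + t) ≡ K * t * suc t * v * (2 + t)
  regroup″ = solve-∀

a*d≤b*c⇒a/c≤b/d : ∀ a b c d .{{_ : NonZero c}} .{{_ : NonZero d}} →
                  a * d ≤ b * c → + a ℚ./ c ℚ.≤ + b ℚ./ d
a*d≤b*c⇒a/c≤b/d a b (suc c) (suc d) ad≤bc = ℚP.toℚᵘ-cancel-≤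
  (ℚᵘP.≤-respˡ-≃ (ℚᵘP.≃-sym (ℚP.toℚᵘ-fromℚᵘ (mkℚᵘ (+ a) c)))
  (ℚᵘP.≤-respʳ-≃ (ℚᵘP.≃-sym (ℚP.toℚᵘ-fromℚᵘ (mkℚᵘ (+ b) d)))
  (*≤* (subst₂ ℤ._≤_ (ℤP.pos-* a (suc d)) (ℤP.pos-* b (suc c)) (ℤ.+≤+ ad≤bc)))))

ratio-≤ : ∀ k x s t .{{_ : NonZero k}} → i k x s * k ^ t ≤ i k x t * k ^ s → ratio k x s ℚ.≤ ratio k x t
ratio-≤ k@(suc _) x s t = a*d≤b*c⇒a/c≤b/d (i k x s) (i k x t) (k ^ s) (k ^ t) {{m^n≢0 k s}} {{m^n≢0 k t}}

i≡0⇒ratio-≤ : ∀ k x s t .{{_ : NonZero k}} → i k x s ≡ 0 → ratio k x s ℚ.≤ ratio k x t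
i≡0⇒ratio-≤ k x s t i≡0 = ratio-≤ k x s t (subst (λ v → v * k ^ t ≤ i k x t * k ^ s) (sym i≡0) z≤n)

v*[k*[k*p]]≡k*k*v*p : ∀ k v p → v * (k * (k * p)) ≡ k * k * v * p
v*[k*[k*p]]≡k*k*v*p = solve-∀

ratio-≤-ratio[2+t] : ∀ k x t .{{_ : NonZero k}} →
                     k * k * i k x t ≤ i k x (2 + t) → ratio k x t ℚ.≤ ratio k x (2 + t)
ratio-≤-ratio[2+t] k x t k²i≤i′ = ratio-≤ k x t (2 + t) (begin
    i k x t * (k * (k * k ^ t))  ≡⟨ v*[k*[k*p]]≡k*k*v*p k (i k x t) (k ^ t) ⟩
    k * k * i k x t * k ^ t      ≤⟨ *-monoˡ-≤ (k ^ t) k²i≤i′ ⟩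
    i k x (2 + t) * k ^ t        ∎)
  where open ≤-Reasoning

ratio[2+t]-≤-ratio : ∀ k x t .{{_ : NonZero k}} →
                     i k x (2 + t) ≤ k * k * i k x t → ratio k x (2 + t) ℚ.≤ ratio k x t
ratio[2+t]-≤-ratio k x t i′≤k²i = ratio-≤ k x (2 + t) t (begin
    i k x (2 + t) * k ^ t        ≤⟨ *-monoˡ-≤ (k ^ t) i′≤k²i ⟩
    k * k * i k x t * k ^ t      ≡⟨ v*[k*[k*p]]≡k*k*v*p k (i k x t) (k ^ t) ⟨
    i k x t * (k * (k * k ^ t))  ∎)
  where open ≤-Reasoning

∣m⊖n∣≤o : ∀ {m n o} → m ≤ n + o → n ≤ m + o → ℤ.∣ m ⊖ n ∣ ≤ o
∣m⊖n∣≤o {m} {n} {o} m≤n+o n≤m+o with ≤-total m n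
... | inj₁ m≤n = subst (_≤ o) (sym (ℤP.∣⊖∣-≤ m≤n)) (m≤n+o⇒m∸n≤o n m n≤m+o)
... | inj₂ n≤m = subst (_≤ o) (sym (trans (ℤP.∣m⊖n∣≡∣n⊖m∣ m n) (ℤP.∣⊖∣-≤ n≤m)))
                       (m≤n+o⇒m∸n≤o m n m≤n+o)

∣p-a/[1+n]*q∣≤c : ∀ p a n q c → p * suc n ≤ a * q + c * suc n → a * q ≤ p * suc n + c * suc n →
                  ℚ.∣ + p ℚ./ 1 ℚ.- (+ a ℚ./ suc n) ℚ.* (+ q ℚ./ 1) ∣ ℚ.≤ + c ℚ./ 1
∣p-a/[1+n]*q∣≤c p a n q c p[1+n]≤aq+c[1+n] aq≤p[1+n]+c[1+n] =
  ℚP.toℚᵘ-cancel-≤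
    (ℚᵘP.≤-respˡ-≃ (ℚᵘP.≃-sym toℚᵘ-lhs) (ℚᵘP.≤-respʳ-≃ (ℚᵘP.≃-sym toℚᵘ-rhs) bound))
  where
  p/1 a/[1+n] q/1 : ℚ
  p/1 = + p ℚ./ 1
  a/[1+n] = + a ℚ./ suc n
  q/1 = + q ℚ./ 1
  difference : ℤ.ℤ
  difference = + (p * suc n) ℤ.- + (a * q)
  toℚᵘ-rhs : ℚ.toℚᵘ (+ c ℚ./ 1) ℚᵘ.≃ mkℚᵘ (+ c) 0
  toℚᵘ-rhs = ℚP.toℚᵘ-fromℚᵘ (mkℚᵘ (+ c) 0)
  toℚᵘ-lhs : ℚ.toℚᵘ (ℚ.∣ p/1 ℚ.- a/[1+n] ℚ.* q/1 ∣) ℚᵘ.≃ ℚᵘ.∣ mkℚᵘ difference n ∣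
  toℚᵘ-lhs = ℚᵘP.≃-trans (ℚP.toℚᵘ-homo-∣-∣ _)
    (ℚᵘP.∣-∣-cong (ℚᵘP.≃-trans toℚᵘ-inner cross-multiplied))
    where
    toℚᵘ-inner : ℚ.toℚᵘ (p/1 ℚ.- a/[1+n] ℚ.* q/1)
                 ℚᵘ.≃ mkℚᵘ (+ p) 0 ℚᵘ.- mkℚᵘ (+ a) n ℚᵘ.* mkℚᵘ (+ q) 0
    toℚᵘ-inner = ℚᵘP.≃-trans (ℚP.toℚᵘ-homo-+ p/1 (ℚ.- (a/[1+n] ℚ.* q/1)))
      (ℚᵘP.+-cong (ℚP.toℚᵘ-fromℚᵘ (mkℚᵘ (+ p) 0))
        (ℚᵘP.≃-trans (ℚP.toℚᵘ-homo‿- (a/[1+n] ℚ.* q/1))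
          (ℚᵘP.-‿cong (ℚᵘP.≃-trans (ℚP.toℚᵘ-homo-* a/[1+n] q/1)
            (ℚᵘP.*-cong (ℚP.toℚᵘ-fromℚᵘ (mkℚᵘ (+ a) n))
                        (ℚP.toℚᵘ-fromℚᵘ (mkℚᵘ (+ q) 0)))))))
    cross-multiplied : mkℚᵘ (+ p) 0 ℚᵘ.- mkℚᵘ (+ a) n ℚᵘ.* mkℚᵘ (+ q) 0
                       ℚᵘ.≃ mkℚᵘ difference n
    cross-multiplied = *≡* numerators
      where
      numerators : (+ p ℤ.* + suc (n * 1) ℤ.+ (ℤ.- (+ a ℤ.* + q)) ℤ.* + 1) ℤ.* + suc n
                   ≡ difference ℤ.* + suc (n * 1 + 0)
      numerators rewrite *-identityʳ n | +-identityʳ n | ℤP.pos-* p (suc n) | ℤP.pos-* a q =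
        ring (+ p) (+ a) (+ q) (+ suc n)
        where
        ring : ∀ p a q d →
               (p ℤ.* d ℤ.+ (ℤ.- (a ℤ.* q)) ℤ.* + 1) ℤ.* d ≡ (p ℤ.* d ℤ.- a ℤ.* q) ℤ.* d
        ring = ℤSolver.solve-∀
  bound : ℚᵘ.∣ mkℚᵘ difference n ∣ ℚᵘ.≤ mkℚᵘ (+ c) 0
  bound = *≤* (subst₂ ℤ._≤_ (ℤP.pos-* (ℤ.∣ difference ∣) 1) (ℤP.pos-* c (suc n))
    (ℤ.+≤+ (subst (_≤ c * suc n) (sym (*-identityʳ _))
      (subst (λ z → ℤ.∣ z ∣ ≤ c * suc n) (sym (ℤP.m-n≡m⊖n (p * suc n) (a * q)))
        (∣m⊖n∣≤o p[1+n]≤aq+c[1+n] aq≤p[1+n]+c[1+n])))))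

-- R(t+2) / R(t) = step-numerator / step-denominator for t = X + 2b, by i-two-step.
step-numerator step-denominator : ℕ → ℕ → ℕ → ℕ
step-numerator   k X b = (k ∸ 1) * (X + 2 * b) * suc (X + 2 * b)
step-denominator k X b = k * k * ((X + suc b) * suc b)

Ascends : ℕ → ℕ → ℕ → Set
Ascends k X b = step-denominator k X b ≤ step-numerator k X b

[1+m][1+b]+6≤X⇒Ascends : ∀ m X b → suc m * suc b + 6 ≤ X → Ascends (3 + m) X b
[1+m][1+b]+6≤X⇒Ascends m X b Y≤X = subst (λ X → Ascends (3 + m) X b) (m+[n∸m]≡n Y≤X)
  (≤-trans (m≤m+n _ _) (≤-reflexive (sym (expand m b (X ∸ (suc m * suc b + 6))))))
  where
  expand : ∀ m b e → let X = suc m * suc b + 6 + e in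
    (2 + m) * (X + 2 * b) * suc (X + 2 * b)
      ≡ (3 + m) * (3 + m) * ((X + suc b) * suc b)
        + (40 + 21 * e + 2 * e * e + 3 * b * e + 29 * m + 13 * m * e + m * e * e + 9 * m * b
           + 4 * m * b * e + 3 * m * m + m * m * e + 3 * m * m * b + m * m * b * e)
  expand = solve-∀

X≤[1+m]b⇒¬Ascends : ∀ m X b → X ≤ suc m * b → ¬ Ascends (3 + m) X b
X≤[1+m]b⇒¬Ascends m X b X≤[1+m]b ascends = contradiction (+-cancelˡ-≤ _ _ 0 (begin
    4 * num + At * At + excess   ≡⟨ expand m X b ⟨
    4 * den + kX * kX            ≤⟨ +-mono-≤ (*-monoʳ-≤ 4 ascends) (*-mono-≤ kX≤At kX≤At) ⟩
    4 * num + At * At            ≡⟨ +-identityʳ _ ⟨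
    4 * num + At * At + 0        ∎)) λ ()
  where
  open ≤-Reasoning
  num den kX At excess : ℕ
  num = step-numerator (3 + m) X b
  den = step-denominator (3 + m) X b
  kX = (3 + m) * X
  At = suc m * (X + 2 * b)
  excess = 4 * (3 + m) * (3 + m) + (4 * m * m + 20 * m + 28) * (X + 2 * b)
  kX≤At : kX ≤ At
  kX≤At = begin
    (3 + m) * X              ≡⟨ split m X ⟩
    suc m * X + 2 * X        ≤⟨ +-monoʳ-≤ (suc m * X) (*-monoʳ-≤ 2 X≤[1+m]b) ⟩
    suc m * X + 2 * (suc m * b) ≡⟨ merge m X b ⟩
    suc m * (X + 2 * b)      ∎
    where
    split : ∀ m X → (3 + m) * X ≡ suc m * X + 2 * X
    split = solve-∀
    merge : ∀ m X b → suc m * X + 2 * (suc m * b) ≡ suc m * (X + 2 * b)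
    merge = solve-∀
  expand : ∀ m X b →
    4 * ((3 + m) * (3 + m) * ((X + suc b) * suc b)) + (3 + m) * X * ((3 + m) * X)
      ≡ 4 * ((2 + m) * (X + 2 * b) * suc (X + 2 * b)) + suc m * (X + 2 * b) * (suc m * (X + 2 * b))
        + (4 * (3 + m) * (3 + m) + (4 * m * m + 20 * m + 28) * (X + 2 * b))
  expand = solve-∀

¬Ascends⇒¬Ascends[1+b] : ∀ m X b → ¬ Ascends (3 + m) X b → ¬ Ascends (3 + m) X (suc b)
¬Ascends⇒¬Ascends[1+b] m X b ¬ascends ascends′ = <-irrefl refl (begin-strict
    den′ + num   <⟨ +-monoʳ-< den′ (≰⇒> ¬ascends) ⟩
    den′ + den   ≤⟨ +-monoˡ-≤ den ascends′ ⟩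
    num′ + den   ≡⟨ +-comm num′ den ⟩
    den + num′   ≤⟨ m≤m+n _ _ ⟩
    den + num′ + (15 + X + 2 * b + 12 * m + 2 * m * X + 4 * m * b + 3 * m * m + m * m * X + 2 * m * m * b)
                 ≡⟨ expand m X b ⟨
    den′ + num   ∎)
  where
  open ≤-Reasoning
  num den num′ den′ : ℕ
  num  = step-numerator (3 + m) X b
  den  = step-denominator (3 + m) X b
  num′ = step-numerator (3 + m) X (suc b)
  den′ = step-denominator (3 + m) X (suc b)
  expand : ∀ m X b →
    (3 + m) * (3 + m) * ((X + suc (suc b)) * suc (suc b)) + (2 + m) * (X + 2 * b) * suc (X + 2 * b)
      ≡ (3 + m) * (3 + m) * ((X + suc b) * suc b) + (2 + m) * (X + 2 * suc b) * suc (X + 2 * suc b)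
        + (15 + X + 2 * b + 12 * m + 2 * m * X + 4 * m * b + 3 * m * m + m * m * X + 2 * m * m * b)
  expand = solve-∀

[3+m]X≤[X+2b][1+m]+15[1+m] : ∀ m X b → X ≤ suc m * suc b + 6 →
                             (3 + m) * X ≤ (X + 2 * b) * suc m + 15 * suc m
[3+m]X≤[X+2b][1+m]+15[1+m] m X b X≤[1+m][1+b]+6 = begin
    (3 + m) * X                                         ≡⟨ split m X ⟩
    suc m * X + 2 * X                                   ≤⟨ +-monoʳ-≤ (suc m * X) (*-monoʳ-≤ 2 X≤[1+m][1+b]+6) ⟩
    suc m * X + 2 * (suc m * suc b + 6)                 ≡⟨ regroup m X b ⟩
    (X + 2 * b) * suc m + 2 * suc m + 12                ≤⟨ m≤m+n _ (1 + 13 * m) ⟩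
    (X + 2 * b) * suc m + 2 * suc m + 12 + (1 + 13 * m) ≡⟨ collect m X b ⟩
    (X + 2 * b) * suc m + 15 * suc m                    ∎
  where
  open ≤-Reasoning
  split : ∀ m X → (3 + m) * X ≡ suc m * X + 2 * X
  split = solve-∀
  regroup : ∀ m X b → suc m * X + 2 * (suc m * suc b + 6) ≡ (X + 2 * b) * suc m + 2 * suc m + 12
  regroup = solve-∀
  collect : ∀ m X b → (X + 2 * b) * suc m + 2 * suc m + 12 + (1 + 13 * m) ≡ (X + 2 * b) * suc m + 15 * suc m
  collect = solve-∀

[X+2b][1+m]≤[3+m]X+15[1+m] : ∀ m X b → suc m * b ≤ X + suc m →
                             (X + 2 * b) * suc m ≤ (3 + m) * X + 15 * suc m
[X+2b][1+m]≤[3+m]X+15[1+m] m X b [1+m]b≤X+1+m = begin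
    (X + 2 * b) * suc m                        ≡⟨ split m X b ⟩
    suc m * X + 2 * (suc m * b)                ≤⟨ +-monoʳ-≤ (suc m * X) (*-monoʳ-≤ 2 [1+m]b≤X+1+m) ⟩
    suc m * X + 2 * (X + suc m)                ≤⟨ m≤m+n _ (13 * suc m) ⟩
    suc m * X + 2 * (X + suc m) + 13 * suc m   ≡⟨ collect m X ⟩
    (3 + m) * X + 15 * suc m                   ∎
  where
  open ≤-Reasoning
  split : ∀ m X b → (X + 2 * b) * suc m ≡ suc m * X + 2 * (suc m * b)
  split = solve-∀
  collect : ∀ m X → suc m * X + 2 * (X + suc m) + 13 * suc m ≡ (3 + m) * X + 15 * suc m
  collect = solve-∀

module Peak (m x : ℕ) where

  k X : ℕ
  k = 3 + m
  X = suc x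

  R : ℕ → ℚ
  R = ratio k X

  t[_] : ℕ → ℕ
  t[ b ] = X + 2 * b

  t[]-cancel : ∀ b c → t[ b ] ≤ t[ c ] → b ≤ c
  t[]-cancel b c t[b]≤t[c] = *-cancelˡ-≤ 2 (+-cancelˡ-≤ X (2 * b) (2 * c) t[b]≤t[c])

  R[2+t[b]]≡R[t[1+b]] : ∀ b → R (2 + t[ b ]) ≡ R t[ suc b ]
  R[2+t[b]]≡R[t[1+b]] b = cong R (shift X b)
    where
    shift : ∀ X b → 2 + (X + 2 * b) ≡ X + 2 * suc b
    shift = solve-∀

  R-rises : ∀ b → Ascends k X b → R t[ b ] ℚ.≤ R t[ suc b ]
  R-rises b ascends = subst (R t[ b ] ℚ.≤_) (R[2+t[b]]≡R[t[1+b]] b) (ratio-≤-ratio[2+t] k X t[ b ]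
    (p*v≡q*u⇒c*p≤q⇒c*u≤v {u = i k X t[ b ]} {v = i k X (2 + t[ b ])} (k * k) (i-two-step k X b) ascends))

  R-falls : ∀ b → ¬ Ascends k X b → R t[ suc b ] ℚ.≤ R t[ b ]
  R-falls b ¬ascends = subst (ℚ._≤ R t[ b ]) (R[2+t[b]]≡R[t[1+b]] b) (ratio[2+t]-≤-ratio k X t[ b ]
    (p*v≡q*u⇒q≤c*p⇒v≤c*u {u = i k X t[ b ]} {v = i k X (2 + t[ b ])} (k * k) (i-two-step k X b)
      (<⇒≤ (≰⇒> ¬ascends))))

  first-descent : ∃[ b ] ¬ Ascends k X b × (∀ c → c < b → Ascends k X c)
  first-descent = least-failure {P = Ascends k X} (λ b → step-denominator k X b ≤? step-numerator k X b) X
    (X≤[1+m]b⇒¬Ascends m X X (m≤n*m X (suc m)))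

  b* t* : ℕ
  b* = proj₁ first-descent
  t* = t[ b* ]

  ¬Ascends[b*] : ¬ Ascends k X b*
  ¬Ascends[b*] = proj₁ (proj₂ first-descent)

  Ascends-below-b* : ∀ b → b < b* → Ascends k X b
  Ascends-below-b* = proj₂ (proj₂ first-descent)

  ¬Ascends-from-b* : ∀ {b} → b* ≤ b → ¬ Ascends k X b
  ¬Ascends-from-b* {b} b*≤b = subst (λ b → ¬ Ascends k X b) (m∸n+n≡m b*≤b) (¬Ascends[d+b*] (b ∸ b*))
    where
    ¬Ascends[d+b*] : ∀ d → ¬ Ascends k X (d + b*)
    ¬Ascends[d+b*] zero    = ¬Ascends[b*]
    ¬Ascends[d+b*] (suc d) = ¬Ascends⇒¬Ascends[1+b] m X (d + b*) (¬Ascends[d+b*] d)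

  R-up-to-peak : ∀ {b c} → b ≤ c → c ≤ b* → R t[ b ] ℚ.≤ R t[ c ]
  R-up-to-peak = ascending-upto {_≼_ = ℚ._≤_} ℚP.≤-refl ℚP.≤-trans (λ b → R t[ b ])
    (λ b b<b* → R-rises b (Ascends-below-b* b b<b*))

  R-past-peak : ∀ {b c} → b* ≤ b → b ≤ c → R t[ c ] ℚ.≤ R t[ b ]
  R-past-peak = descending-from {_≼_ = ℚ._≤_} ℚP.≤-refl ℚP.≤-trans (λ b → R t[ b ])
    (λ b b*≤b → R-falls b (¬Ascends-from-b* b*≤b))

  Admissible : ℕ → Set
  Admissible t = 0 < t × t % 2 ≡ X % 2

  t*-admissible : Admissible t*
  t*-admissible = s≤s z≤n , trans (cong (λ n → (X + n) % 2) (*-comm 2 b*)) ([m+kn]%n≡m%n X b* 2)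

  X≤t[b] : ∀ {t} → ∃[ b ] t ≡ t[ b ] → X ≤ t
  X≤t[b] (b , refl) = m≤m+n X (2 * b)

  R-rising-between : ∀ {s t} → ∃[ b ] s ≡ t[ b ] → ∃[ c ] t ≡ t[ c ] →
                     s ≤ t → t ≤ t* → R s ℚ.≤ R t
  R-rising-between (b , refl) (c , refl) s≤t t≤t* =
    R-up-to-peak {b} {c} (t[]-cancel b c s≤t) (t[]-cancel c b* t≤t*)

  R-falling-between : ∀ {s t} → ∃[ b ] s ≡ t[ b ] → ∃[ c ] t ≡ t[ c ] →
                      t* ≤ s → s ≤ t → R t ℚ.≤ R s
  R-falling-between (b , refl) (c , refl) t*≤s s≤t =
    R-past-peak {b} {c} (t[]-cancel b* b t*≤s) (t[]-cancel b c s≤t)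

  R-monotone-before-peak : ∀ s t → Admissible s × s ≤ t* → Admissible t × t ≤ t* →
                           s ≤ t → R s ℚ.≤ R t
  R-monotone-before-peak s t _ ((_ , t%2≡X%2) , t≤t*) s≤t =
    [ i≡0⇒ratio-≤ k X s t , rising ]′ (i-support k X s)
    where
    rising : ∃[ b ] s ≡ t[ b ] → R s ℚ.≤ R t
    rising s≡t[b] =
      R-rising-between s≡t[b] (parity-gap (≤-trans (X≤t[b] s≡t[b]) s≤t) t%2≡X%2) s≤t t≤t*

  R-monotone-after-peak : ∀ s t → Admissible s × t* ≤ s → Admissible t × t* ≤ t →
                          s ≤ t → R t ℚ.≤ R s
  R-monotone-after-peak s t ((_ , s%2≡X%2) , t*≤s) ((_ , t%2≡X%2) , t*≤t) s≤t =
    R-falling-between (parity-gap (≤-trans (m≤m+n X _) t*≤s) s%2≡X%2)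
                      (parity-gap (≤-trans (m≤m+n X _) t*≤t) t%2≡X%2) t*≤s s≤t

  R[t[b]]≤R[t*] : ∀ b → R t[ b ] ℚ.≤ R t*
  R[t[b]]≤R[t*] b = [ (λ b≤b* → R-up-to-peak {b} {b*} b≤b* ≤-refl)
                    , (λ b*≤b → R-past-peak {b*} {b} ≤-refl b*≤b) ]′ (≤-total b b*)

  R≤R[t*] : ∀ t → R t ℚ.≤ R t*
  R≤R[t*] t = [ i≡0⇒ratio-≤ k X t t*
              , (λ (b , t≡t[b]) → subst (λ t → R t ℚ.≤ R t*) (sym t≡t[b]) (R[t[b]]≤R[t*] b)) ]′
              (i-support k X t)

  X≤[1+m][1+b*]+6 : X ≤ suc m * suc b* + 6
  X≤[1+m][1+b*]+6 = <⇒≤ (≰⇒> (¬Ascends[b*] ∘ [1+m][1+b]+6≤X⇒Ascends m X b*))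

  [1+m]b*≤X+[1+m] : suc m * b* ≤ X + suc m
  [1+m]b*≤X+[1+m] = below b* Ascends-below-b*
    where
    below : ∀ b → (∀ c → c < b → Ascends k X c) → suc m * b ≤ X + suc m
    below zero    _       = ≤-trans (≤-reflexive (*-zeroʳ (suc m))) z≤n
    below (suc c) ascends = begin
      suc m * suc c      ≡⟨ *-suc (suc m) c ⟩
      suc m + suc m * c  ≤⟨ +-monoʳ-≤ (suc m) [1+m]c≤X ⟩
      suc m + X          ≡⟨ +-comm (suc m) X ⟩
      X + suc m          ∎
      where
      open ≤-Reasoning
      [1+m]c≤X : suc m * c ≤ X
      [1+m]c≤X = <⇒≤ (≰⇒> (λ X≤[1+m]c → X≤[1+m]b⇒¬Ascends m X c X≤[1+m]c (ascends c (n<1+n c))))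

  t*-near-λX : ℚ.∣ + t* ℚ./ 1 ℚ.- lam k ℚ.* (+ X ℚ./ 1) ∣ ℚ.≤ + 15 ℚ./ 1
  t*-near-λX = ∣p-a/[1+n]*q∣≤c t* k m X 15
    ([X+2b][1+m]≤[3+m]X+15[1+m] m X b* [1+m]b*≤X+[1+m])
    ([3+m]X≤[X+2b][1+m]+15[1+m] m X b* X≤[1+m][1+b*]+6)

lemma3 : (k : ℕ) → 3 ≤ k → (x : ℕ) → 1 ≤ x →
    UnimodalOn (λ t → 0 < t × t % 2 ≡ x % 2) (ratio k x) ×
    Σ ℕ (λ tmax → (∀ t → ratio k x t ℚ.≤ ratio k x tmax) ×
      ℚ.∣ ((+ tmax) ℚ./ 1) ℚ.- lam k ℚ.* ((+ x) ℚ./ 1) ∣ ℚ.≤ ((+ 15) ℚ./ 1))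
lemma3 (suc (suc (suc m))) (s≤s (s≤s (s≤s z≤n))) (suc x) (s≤s z≤n) =
  (t* , t*-admissible , inj₁ R-monotone-before-peak , inj₂ R-monotone-after-peak) ,
  (t* , R≤R[t*] , t*-near-λX)
  where open Peak m x
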